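{- Let $\Lambda$ be a $k$-graph. The equivalence relation $\sim$ on $\bigsqcup_{\lambda\in\Lambda}\{\lambda\}\times[0,d(\lambda)]$ defining $X_\Lambda$ is the equivalence relation generated by the relation \[ \big\{\big((\alpha\lambda\beta,t+d(\alpha)),(\lambda,t)\big):d(\lambda)\le\mathbf{1}_k,\ t\in[0,d(\lambda)]\big\}, \] where $\alpha,\beta$ range over paths with $s(\alpha)=r(\lambda)$ and $r(\beta)=s(\lambda)$.
   Context: A $k$-graph is a countable small category $\Lambda$ with a functor $d:\Lambda\to\mathbb{N}^k$ satisfying the unique factorization property. $\mathbf{1}_k=(1,\dots,1)$. For $m\le n\le d(\lambda)$, $\lambda(m,n)$ is the factor of degree $n-m$ in $\lambda=\lambda'\lambda(m,n)\lambda'''$ with $d(\lambda')=m$. The relation $\sim$ is defined by $(\mu,s)\sim(\nu,t)$ if and only if $\mu(\lfloor s\rfloor,\lceil s\rceil)=\nu(\lfloor t\rfloor,\lceil t\rceil)$ and $s-\lfloor s\rfloor=t-\lfloor t\rfloor$, where $\lfloor\cdot\rfloor,\lceil\cdot\rceil$ are the coordinatewise floor and ceiling in $\mathbb{Z}^k$, and $[0,d(\lambda)]=\{t\in\mathbb{R}^k:0\le t\le d(\lambda)\}$. -}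

module Defs where

open import Level using (0ℓ)
open import Data.Nat as ℕ using (ℕ; zero; suc)
open import Data.Integer as ℤ using (ℤ; +_; -[1+_]; ∣_∣)
open import Data.Fin using (Fin)
open import Data.Vec using (Vec; lookup; zipWith; replicate; tabulate)
open import Data.Product using (Σ; Σ-syntax; ∃; _×_; _,_)
open import Relation.Binary.PropositionalEquality using (_≡_)
open import Relation.Nullary using (¬_)
open import Relation.Binary using (Rel; IsTotalOrder)
open import Relation.Binary.Construct.Closure.Equivalence using (EqClosure)
open import Algebra.Structures using (IsCommutativeRing)
open import Function using (Injective)

-- The real numbers, axiomatised as a Dedekind-complete ordered field
-- (unique up to isomorphism), equipped with the floor function.

natToR : {A : Set} → A → A → (A → A → A) → ℕ → A
natToR z o p zero = z
natToR z o p (suc n) = p o (natToR z o p n)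

intToR : {A : Set} → A → A → (A → A → A) → (A → A) → ℤ → A
intToR z o p m (+ n) = natToR z o p n
intToR z o p m -[1+ n ] = m (natToR z o p (suc n))

record RealNumbers : Set₁ where
  infixl 6 _+_
  infixl 7 _*_
  infix 4 _≈_ _≤_
  field
    Carrier : Set
    _≈_ : Rel Carrier 0ℓ
    _+_ _*_ : Carrier → Carrier → Carrier
    -_ : Carrier → Carrier
    0# 1# : Carrier
    isCommutativeRing : IsCommutativeRing _≈_ _+_ _*_ -_ 0# 1#
    0≉1 : ¬ (0# ≈ 1#)
    inverse : ∀ x → ¬ (x ≈ 0#) → Σ Carrier (λ y → x * y ≈ 1#)
    _≤_ : Rel Carrier 0ℓ
    isTotalOrder : IsTotalOrder _≈_ _≤_
    +-mono-≤ : ∀ {x y} z → x ≤ y → x + z ≤ y + z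
    *-nonneg : ∀ {x y} → 0# ≤ x → 0# ≤ y → 0# ≤ x * y
    complete : (P : Carrier → Set) → Σ Carrier P →
               Σ Carrier (λ b → ∀ x → P x → x ≤ b) →
               Σ Carrier (λ s → (∀ x → P x → x ≤ s) ×
                                (∀ b → (∀ x → P x → x ≤ b) → s ≤ b))

    floor : Carrier → ℤ
    floor-≤ : ∀ x → intToR 0# 1# _+_ -_ (floor x) ≤ x
    floor-> : ∀ x → x ≤ intToR 0# 1# _+_ -_ (floor x) + 1# ×
                    ¬ (x ≈ intToR 0# 1# _+_ -_ (floor x) + 1#)

  fromℕ : ℕ → Carrier
  fromℕ = natToR 0# 1# _+_

  fromℤ : ℤ → Carrier
  fromℤ = intToR 0# 1# _+_ -_

  ceil : Carrier → ℤ
  ceil x = ℤ.- floor (- x)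

_⊕_ : ∀ {k} → Vec ℕ k → Vec ℕ k → Vec ℕ k
_⊕_ = zipWith ℕ._+_

-- Path v w : paths λ with r(λ) = v and s(λ) = w.
-- Composition μ ∘ ν is the path μν (defined when s(μ) = r(ν)).
record KGraph (k : ℕ) : Set₁ where
  infixl 9 _∘_
  field
    Obj : Set
    Path : Obj → Obj → Set
    idP : ∀ {v} → Path v v
    _∘_ : ∀ {u v w} → Path u v → Path v w → Path u w
    idˡ : ∀ {u v} (f : Path u v) → idP ∘ f ≡ f
    idʳ : ∀ {u v} (f : Path u v) → f ∘ idP ≡ f
    assoc : ∀ {u v w x} (f : Path u v) (g : Path v w) (h : Path w x) →
            (f ∘ g) ∘ h ≡ f ∘ (g ∘ h)
    d : ∀ {u v} → Path u v → Vec ℕ k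
    d-id : ∀ {v} → d (idP {v}) ≡ replicate k 0
    d-∘ : ∀ {u v w} (f : Path u v) (g : Path v w) → d (f ∘ g) ≡ d f ⊕ d g
    code : Σ Obj (λ u → Σ Obj (λ w → Path u w)) → ℕ
    code-injective : Injective _≡_ _≡_ code
    factor : ∀ {u w} (l : Path u w) (m n : Vec ℕ k) → d l ≡ m ⊕ n →
             Σ Obj (λ v → Σ (Path u v) (λ μ → Σ (Path v w) (λ ν →
               d μ ≡ m × d ν ≡ n × l ≡ μ ∘ ν)))
    factor-unique : ∀ {u w} (l : Path u w) (m n : Vec ℕ k) →
             ∀ {v v'} (μ : Path u v) (ν : Path v w) (μ' : Path u v') (ν' : Path v' w) →
             d μ ≡ m → d ν ≡ n → l ≡ μ ∘ ν →
             d μ' ≡ m → d ν' ≡ n → l ≡ μ' ∘ ν' →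
             _≡_ {A = Σ Obj (λ x → Path u x × Path x w)} (v , μ , ν) (v' , μ' , ν')

  AnyPath : Set
  AnyPath = Σ Obj (λ u → Σ Obj (λ w → Path u w))

  dA : AnyPath → Vec ℕ k
  dA (_ , _ , l) = d l

  -- Segment l m n τ  :  τ = l(m,n), i.e. l = l' τ l''' with d(l') = m, d(τ) = n - m.
  Segment : AnyPath → Vec ℕ k → Vec ℕ k → AnyPath → Set
  Segment (u , w , l) m n (a , b , τ) =
    Σ (Path u a) λ l' → Σ (Path b w) λ l''' →
      l ≡ (l' ∘ τ) ∘ l''' × d l' ≡ m × m ⊕ d τ ≡ n

module Topological {k : ℕ} (Λ : KGraph k) (ℝ : RealNumbers) where
  open KGraph Λ
  open RealNumbers ℝ

  Point : Set
  Point = Σ AnyPath λ l → Σ (Fin k → Carrier) λ t →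
            ∀ i → 0# ≤ t i × t i ≤ fromℕ (lookup (dA l) i)

  ⌊_⌋ ⌈_⌉ : (Fin k → Carrier) → Vec ℕ k
  ⌊ t ⌋ = tabulate (λ i → ∣ floor (t i) ∣)
  ⌈ t ⌉ = tabulate (λ i → ∣ ceil (t i) ∣)

  _∼_ : Rel Point 0ℓ
  (μ , s , _) ∼ (ν , t , _) =
    Σ AnyPath (λ τ → Segment μ ⌊ s ⌋ ⌈ s ⌉ τ × Segment ν ⌊ t ⌋ ⌈ t ⌉ τ)
    × (∀ i → s i + - fromℤ (floor (s i)) ≈ t i + - fromℤ (floor (t i)))

  Gen : Rel Point 0ℓ
  Gen (p , s , _) ((v , w , l) , t , _) =
    (∀ i → lookup (d l) i ℕ.≤ 1) ×
    Σ Obj λ u → Σ Obj λ x → Σ (Path u v) λ α → Σ (Path w x) λ β →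
      p ≡ (u , x , (α ∘ l) ∘ β) ×
      (∀ i → s i ≈ t i + fromℕ (lookup (d α) i))

  Generated : Rel Point 0ℓ
  Generated = EqClosure Gen

module Submission where

-- Every point (l, t) determines its cube τ = l(⌊t⌋, ⌈t⌉) (a path of degree ≤ 1ₖ, by unique
-- factorisation) and its fractional part t - ⌊t⌋ ∈ [0, d(τ)]; (l, t) ∼ (l', t') says exactly that
-- these two invariants agree.
--  * ∼ is an equivalence relation (reflexivity needs the existence of the cube, transitivity its
--    uniqueness), and each generating pair is ∼-related because translating t by d(α) translates
--    ⌊t⌋ and ⌈t⌉ by d(α) and leaves the fractional part unchanged; so the closure of Gen lies in ∼.
--  * Conversely, writing l = l₁ τ l₃ with d(l₁) = ⌊t⌋, the pair ((l, t), (τ, t - ⌊t⌋)) is itself a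
--    generator; two ∼-related points are therefore joined by the zig-zag
--    (l, s) → (τ, s - ⌊s⌋) → (τ, t - ⌊t⌋) ← (l', t').

open import Defs
open import Data.Nat using (ℕ)
open import Data.Product using (_×_)

open import Level using (0ℓ)
open import Data.Nat as ℕ using (zero; suc)
import Data.Nat.Properties as ℕP
open import Data.Integer using (+_; -[1+_]; ∣_∣)
import Data.Integer.Properties as ℤP
open import Data.Fin using (Fin)
open import Data.Vec using (Vec; lookup; tabulate)
open import Data.Vec.Properties using (lookup-zipWith; lookup∘tabulate; lookup-replicate; zipWith-assoc)
open import Data.Vec.Relation.Binary.Pointwise.Extensional using (ext; Pointwise-≡⇒≡)
open import Data.Product using (Σ; _,_; proj₁; proj₂)
open import Data.Sum using (inj₁; inj₂)
open import Data.Empty using (⊥-elim)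
open import Relation.Nullary using (yes; no)
open import Relation.Binary.PropositionalEquality as ≡ using (_≡_)
open import Relation.Binary.Bundles using (Poset)
open import Relation.Binary.Structures using (IsTotalOrder; IsEquivalence)
open import Relation.Binary.Construct.Closure.Equivalence using (fold)
open import Relation.Binary.Construct.Closure.ReflexiveTransitive using (ε; _◅_)
open import Relation.Binary.Construct.Closure.Symmetric using (SymClosure; fwd; bwd)
open import Algebra.Bundles using (CommutativeRing)

module RealFacts (ℝ : RealNumbers) where
  open RealNumbers ℝ
    using (_≤_; isTotalOrder; +-mono-≤; *-nonneg; 0≉1; floor; floor-≤; floor->; ceil; fromℕ; fromℤ)

  commutativeRing : CommutativeRing 0ℓ 0ℓ
  commutativeRing = record { isCommutativeRing = RealNumbers.isCommutativeRing ℝ }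

  open CommutativeRing commutativeRing
  open import Algebra.Properties.Ring ring
    using (-‿involutive; -0#≈0#; -1*x≈-x; -‿+-comm; +-cancelʳ; +-identityˡ-unique;
           //-rightDividesˡ; //-rightDividesʳ; \\-leftDividesˡ)

  module ≤ = IsTotalOrder isTotalOrder

  poset : Poset 0ℓ 0ℓ 0ℓ
  poset = record { isPartialOrder = ≤.isPartialOrder }

  open import Relation.Binary.Construct.NonStrictToStrict _≈_ _≤_ using (_<_; <⇒≱)
  open import Relation.Binary.Reasoning.PartialOrder poset

  +-monoʳ-≤ : ∀ z {x y} → x ≤ y → z + x ≤ z + y
  +-monoʳ-≤ z {x} {y} x≤y = begin
    z + x ≈⟨ +-comm z x ⟩
    x + z ≤⟨ +-mono-≤ z x≤y ⟩
    y + z ≈⟨ +-comm y z ⟩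
    z + y ∎

  +-cancelʳ-≤ : ∀ z {x y} → x + z ≤ y + z → x ≤ y
  +-cancelʳ-≤ z {x} {y} le = begin
    x               ≈⟨ //-rightDividesʳ z x ⟨
    x + z + - z     ≤⟨ +-mono-≤ (- z) le ⟩
    y + z + - z     ≈⟨ //-rightDividesʳ z y ⟩
    y               ∎

  +-monoˡ-< : ∀ z {x y} → x < y → x + z < y + z
  +-monoˡ-< z (x≤y , x≉y) = +-mono-≤ z x≤y , λ e → x≉y (+-cancelʳ z _ _ e)

  x≤x+p : ∀ x {p} → 0# ≤ p → x ≤ x + p
  x≤x+p x {p} 0≤p = begin
    x      ≈⟨ +-identityʳ x ⟨
    x + 0# ≤⟨ +-monoʳ-≤ x 0≤p ⟩
    x + p  ∎

  neg-antitone : ∀ {x y} → x ≤ y → - y ≤ - x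
  neg-antitone {x} {y} x≤y = begin
    - y              ≈⟨ \\-leftDividesˡ x (- y) ⟨
    x + (- x + - y)  ≤⟨ +-mono-≤ (- x + - y) x≤y ⟩
    y + (- x + - y)  ≈⟨ +-congˡ (+-comm (- x) (- y)) ⟩
    y + (- y + - x)  ≈⟨ \\-leftDividesˡ y (- x) ⟩
    - x              ∎

  neg-flip : ∀ {x y} → - x ≤ - y → y ≤ x
  neg-flip {x} {y} le = begin
    y      ≈⟨ -‿involutive y ⟨
    - - y  ≤⟨ neg-antitone le ⟩
    - - x  ≈⟨ -‿involutive x ⟩
    x      ∎

  neg-flip-< : ∀ {x y} → - x < - y → y < x
  neg-flip-< (le , ≉) = neg-flip le , λ e → ≉ (-‿cong (sym e))

  neg-nonpos : ∀ {x} → 0# ≤ x → - x ≤ 0#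
  neg-nonpos {x} 0≤x = begin
    - x  ≤⟨ neg-antitone 0≤x ⟩
    - 0# ≈⟨ -0#≈0# ⟩
    0#   ∎

  -- In an ordered ring 1 is positive: otherwise 0 ≤ -1, so 0 ≤ (-1)(-1) = 1.
  0≤1 : 0# ≤ 1#
  0≤1 with ≤.total 0# 1#
  ... | inj₁ 0≤1 = 0≤1
  ... | inj₂ 1≤0 = ⊥-elim (0≉1 (≤.antisym 0≤1' 1≤0))
    where
    0≤-1 : 0# ≤ - 1#
    0≤-1 = begin
      0#    ≈⟨ -0#≈0# ⟨
      - 0#  ≤⟨ neg-antitone 1≤0 ⟩
      - 1#  ∎
    0≤1' : 0# ≤ 1#
    0≤1' = begin
      0#          ≤⟨ *-nonneg 0≤-1 0≤-1 ⟩
      - 1# * - 1# ≈⟨ -1*x≈-x (- 1#) ⟩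
      - - 1#      ≈⟨ -‿involutive 1# ⟩
      1#          ∎

  x<1+x : ∀ x → x < 1# + x
  x<1+x x = ≤.≤-respʳ-≈ (+-comm x 1#) (x≤x+p x 0≤1) ,
            λ e → 0≉1 (sym (+-identityˡ-unique 1# x (sym e)))

  fromℕ-+ : ∀ m n → fromℕ (m ℕ.+ n) ≈ fromℕ m + fromℕ n
  fromℕ-+ zero n = sym (+-identityˡ (fromℕ n))
  fromℕ-+ (suc m) n = begin-equality
    1# + fromℕ (m ℕ.+ n)      ≈⟨ +-congˡ (fromℕ-+ m n) ⟩
    1# + (fromℕ m + fromℕ n)  ≈⟨ +-assoc 1# (fromℕ m) (fromℕ n) ⟨
    1# + fromℕ m + fromℕ n    ∎

  fromℕ-nonneg : ∀ n → 0# ≤ fromℕ n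
  fromℕ-nonneg zero = ≤.refl
  fromℕ-nonneg (suc n) = begin
    0#           ≤⟨ fromℕ-nonneg n ⟩
    fromℕ n      <⟨ x<1+x (fromℕ n) ⟩
    1# + fromℕ n ∎

  fromℕ-mono-≤ : ∀ {m n} → m ℕ.≤ n → fromℕ m ≤ fromℕ n
  fromℕ-mono-≤ {m} {n} m≤n = begin
    fromℕ m                     ≤⟨ x≤x+p (fromℕ m) (fromℕ-nonneg (n ℕ.∸ m)) ⟩
    fromℕ m + fromℕ (n ℕ.∸ m)   ≈⟨ fromℕ-+ m (n ℕ.∸ m) ⟨
    fromℕ (m ℕ.+ (n ℕ.∸ m))     ≡⟨ ≡.cong fromℕ (ℕP.m+[n∸m]≡n m≤n) ⟩
    fromℕ n                     ∎

  fromℕ-mono-< : ∀ {m n} → m ℕ.< n → fromℕ m < fromℕ n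
  fromℕ-mono-< {m} {n} m<n = begin-strict
    fromℕ m        <⟨ x<1+x (fromℕ m) ⟩
    fromℕ (suc m)  ≤⟨ fromℕ-mono-≤ m<n ⟩
    fromℕ n        ∎

  fromℕ-cancel-≤ : ∀ {m n} → fromℕ m ≤ fromℕ n → m ℕ.≤ n
  fromℕ-cancel-≤ {m} {n} le with m ℕ.≤? n
  ... | yes m≤n = m≤n
  ... | no m≰n = ⊥-elim (<⇒≱ ≤.antisym (fromℕ-mono-< (ℕP.≰⇒> m≰n)) le)

  fromℕ-cancel-< : ∀ {m n} → fromℕ m < fromℕ n → m ℕ.< n
  fromℕ-cancel-< {m} {n} lt with suc m ℕ.≤? n
  ... | yes m<n = m<n
  ... | no m≮n = ⊥-elim (<⇒≱ ≤.antisym lt (fromℕ-mono-≤ (ℕP.≤-pred (ℕP.≰⇒> m≮n))))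

  IsFloor : Carrier → ℕ → Set
  IsFloor x f = fromℕ f ≤ x × x < fromℕ (suc f)

  IsCeil : Carrier → ℕ → Set
  IsCeil x c = x ≤ fromℕ c × (∀ m → x ≤ fromℕ m → c ℕ.≤ m)

  neg-suc+1 : ∀ n → - (1# + fromℕ n) + 1# ≈ - fromℕ n
  neg-suc+1 n = begin-equality
    - (1# + fromℕ n) + 1#      ≈⟨ +-congʳ (-‿+-comm 1# (fromℕ n)) ⟨
    - 1# + - fromℕ n + 1#      ≈⟨ +-congʳ (+-comm (- 1#) (- fromℕ n)) ⟩
    - fromℕ n + - 1# + 1#      ≈⟨ //-rightDividesˡ 1# (- fromℕ n) ⟩
    - fromℕ n                  ∎

  floor-nonneg : ∀ {x} → 0# ≤ x → floor x ≡ + ∣ floor x ∣ × IsFloor x ∣ floor x ∣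
  floor-nonneg {x} 0≤x with floor x | floor-≤ x | floor-> x
  ... | + f | f≤x | x≤f+1 , x≉f+1 =
    ≡.refl , f≤x , ≤.≤-respʳ-≈ (+-comm (fromℕ f) 1#) x≤f+1 , λ e → x≉f+1 (trans e (+-comm 1# (fromℕ f)))
  ... | -[1+ n ] | _ | x<-n = ⊥-elim (<⇒≱ ≤.antisym x<-n (begin
    - (1# + fromℕ n) + 1#  ≈⟨ neg-suc+1 n ⟩
    - fromℕ n              ≤⟨ neg-nonpos (fromℕ-nonneg n) ⟩
    0#                     ≤⟨ 0≤x ⟩
    x                      ∎))

  isFloor : ∀ {x} → 0# ≤ x → IsFloor x ∣ floor x ∣
  isFloor 0≤x = proj₂ (floor-nonneg 0≤x)

  -- ceil x = - floor (- x); for x ≥ 0 either floor (- x) = 0, or floor (- x) = -(n + 1) with n < x ≤ n + 1.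
  ceil-nonneg : ∀ {x} → 0# ≤ x → IsCeil x ∣ ceil x ∣
  ceil-nonneg {x} 0≤x rewrite ℤP.∣-i∣≡∣i∣ (floor (- x)) with floor (- x) | floor-≤ (- x) | floor-> (- x)
  ... | + n | n≤-x | _ = x≤n , λ m _ → fromℕ-cancel-≤ (begin
    fromℕ n  ≤⟨ n≤-x ⟩
    - x      ≤⟨ neg-nonpos 0≤x ⟩
    0#       ≤⟨ fromℕ-nonneg m ⟩
    fromℕ m  ∎)
    where
    x≤n : x ≤ fromℕ n
    x≤n = begin
      x        ≤⟨ neg-flip (begin
        - 0#     ≈⟨ -0#≈0# ⟩
        0#       ≤⟨ fromℕ-nonneg n ⟩
        fromℕ n  ≤⟨ n≤-x ⟩
        - x      ∎) ⟩
      0#       ≤⟨ fromℕ-nonneg n ⟩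
      fromℕ n  ∎
  ... | -[1+ n ] | -[1+n]≤-x | -x<-n+1 = neg-flip -[1+n]≤-x , λ m x≤m → fromℕ-cancel-< (begin-strict
    fromℕ n  <⟨ neg-flip-< (≤.≤-respʳ-≈ (neg-suc+1 n) (proj₁ -x<-n+1) , λ e → proj₂ -x<-n+1 (trans e (sym (neg-suc+1 n)))) ⟩
    x        ≤⟨ x≤m ⟩
    fromℕ m  ∎)

  floor-unique : ∀ {x f g} → IsFloor x f → IsFloor x g → f ≡ g
  floor-unique (f≤x , x<f+1) (g≤x , x<g+1) = ℕP.≤-antisym
    (ℕP.≤-pred (fromℕ-cancel-< (begin-strict _ ≤⟨ f≤x ⟩ _ <⟨ x<g+1 ⟩ _ ∎)))
    (ℕP.≤-pred (fromℕ-cancel-< (begin-strict _ ≤⟨ g≤x ⟩ _ <⟨ x<f+1 ⟩ _ ∎)))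

  ceil-unique : ∀ {x c c'} → IsCeil x c → IsCeil x c' → c ≡ c'
  ceil-unique (x≤c , c-least) (x≤c' , c'-least) = ℕP.≤-antisym (c-least _ x≤c') (c'-least _ x≤c)

  floor≤ceil : ∀ {x f c} → IsFloor x f → IsCeil x c → f ℕ.≤ c
  floor≤ceil (f≤x , _) (x≤c , _) = fromℕ-cancel-≤ (≤.trans f≤x x≤c)

  ceil≤1+floor : ∀ {x f c} → IsFloor x f → IsCeil x c → c ℕ.≤ suc f
  ceil≤1+floor (_ , x<f+1) (_ , c-least) = c-least _ (proj₁ x<f+1)

  IsFloor-shift : ∀ {s t a f} → s ≈ t + fromℕ a → IsFloor t f → IsFloor s (a ℕ.+ f)
  IsFloor-shift {s} {t} {a} {f} s≈t+a (f≤t , t<f+1) = lower , upper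
    where
    fromℕ-a+ : ∀ n → fromℕ (a ℕ.+ n) ≈ fromℕ n + fromℕ a
    fromℕ-a+ n = trans (fromℕ-+ a n) (+-comm (fromℕ a) (fromℕ n))
    lower : fromℕ (a ℕ.+ f) ≤ s
    lower = begin
      fromℕ (a ℕ.+ f)    ≈⟨ fromℕ-a+ f ⟩
      fromℕ f + fromℕ a  ≤⟨ +-mono-≤ (fromℕ a) f≤t ⟩
      t + fromℕ a        ≈⟨ s≈t+a ⟨
      s                  ∎
    upper : s < fromℕ (suc (a ℕ.+ f))
    upper = begin-strict
      s                        ≈⟨ s≈t+a ⟩
      t + fromℕ a              <⟨ +-monoˡ-< (fromℕ a) t<f+1 ⟩
      fromℕ (suc f) + fromℕ a  ≈⟨ fromℕ-a+ (suc f) ⟨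
      fromℕ (a ℕ.+ suc f)      ≡⟨ ≡.cong fromℕ (ℕP.+-suc a f) ⟩
      fromℕ (suc (a ℕ.+ f))    ∎

  IsCeil-shift : ∀ {s t a c} → 0# ≤ t → s ≈ t + fromℕ a → IsCeil t c → IsCeil s (a ℕ.+ c)
  IsCeil-shift {s} {t} {a} {c} 0≤t s≈t+a (t≤c , c-least) = s≤a+c , a+c-least
    where
    s≤a+c : s ≤ fromℕ (a ℕ.+ c)
    s≤a+c = begin
      s                  ≈⟨ s≈t+a ⟩
      t + fromℕ a        ≤⟨ +-mono-≤ (fromℕ a) t≤c ⟩
      fromℕ c + fromℕ a  ≈⟨ +-comm (fromℕ c) (fromℕ a) ⟩
      fromℕ a + fromℕ c  ≈⟨ fromℕ-+ a c ⟨
      fromℕ (a ℕ.+ c)    ∎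
    -- if s ≤ m then a ≤ m (as t ≥ 0) and t ≤ m - a, so c ≤ m - a
    a+c-least : ∀ m → s ≤ fromℕ m → a ℕ.+ c ℕ.≤ m
    a+c-least m s≤m = ≡.subst (a ℕ.+ c ℕ.≤_) (ℕP.m+[n∸m]≡n a≤m) (ℕP.+-monoʳ-≤ a (c-least (m ℕ.∸ a) t≤m-a))
      where
      a≤m : a ℕ.≤ m
      a≤m = fromℕ-cancel-≤ (begin
        fromℕ a       ≤⟨ ≤.≤-respʳ-≈ (+-comm (fromℕ a) t) (x≤x+p (fromℕ a) 0≤t) ⟩
        t + fromℕ a   ≈⟨ s≈t+a ⟨
        s             ≤⟨ s≤m ⟩
        fromℕ m       ∎)
      t≤m-a : t ≤ fromℕ (m ℕ.∸ a)
      t≤m-a = +-cancelʳ-≤ (fromℕ a) (begin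
        t + fromℕ a                  ≈⟨ s≈t+a ⟨
        s                            ≤⟨ s≤m ⟩
        fromℕ m                      ≡⟨ ≡.cong fromℕ (ℕP.m∸n+n≡m a≤m) ⟨
        fromℕ (m ℕ.∸ a ℕ.+ a)        ≈⟨ fromℕ-+ (m ℕ.∸ a) a ⟩
        fromℕ (m ℕ.∸ a) + fromℕ a    ∎)

  frac : Carrier → Carrier
  frac x = x + - fromℤ (floor x)

  frac-nonneg : ∀ {x} → 0# ≤ x → frac x ≈ x + - fromℕ ∣ floor x ∣
  frac-nonneg 0≤x = +-congˡ (-‿cong (reflexive (≡.cong fromℤ (proj₁ (floor-nonneg 0≤x)))))

  frac+floor : ∀ {x} → 0# ≤ x → frac x + fromℕ ∣ floor x ∣ ≈ x
  frac+floor {x} 0≤x = trans (+-congʳ (frac-nonneg 0≤x)) (//-rightDividesˡ (fromℕ ∣ floor x ∣) x)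

  shifted-nonneg : ∀ {s t a} → 0# ≤ t → s ≈ t + fromℕ a → 0# ≤ s
  shifted-nonneg {s} {t} {a} 0≤t s≈t+a = begin
    0#           ≤⟨ 0≤t ⟩
    t            ≤⟨ x≤x+p t (fromℕ-nonneg a) ⟩
    t + fromℕ a  ≈⟨ s≈t+a ⟨
    s            ∎

  floor-shift : ∀ {s t a} → 0# ≤ t → s ≈ t + fromℕ a → ∣ floor s ∣ ≡ a ℕ.+ ∣ floor t ∣
  floor-shift {a = a} 0≤t s≈t+a =
    floor-unique (isFloor (shifted-nonneg {a = a} 0≤t s≈t+a)) (IsFloor-shift {a = a} s≈t+a (isFloor 0≤t))

  ceil-shift : ∀ {s t a} → 0# ≤ t → s ≈ t + fromℕ a → ∣ ceil s ∣ ≡ a ℕ.+ ∣ ceil t ∣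
  ceil-shift {a = a} 0≤t s≈t+a =
    ceil-unique (ceil-nonneg (shifted-nonneg {a = a} 0≤t s≈t+a)) (IsCeil-shift {a = a} 0≤t s≈t+a (ceil-nonneg 0≤t))

  frac-shift : ∀ {s t a} → 0# ≤ t → s ≈ t + fromℕ a → frac s ≈ frac t
  frac-shift {s} {t} {a} 0≤t s≈t+a = begin-equality
    frac s                                   ≈⟨ frac-nonneg (shifted-nonneg {a = a} 0≤t s≈t+a) ⟩
    s + - fromℕ ∣ floor s ∣                  ≡⟨ ≡.cong (λ n → s + - fromℕ n) (floor-shift {a = a} 0≤t s≈t+a) ⟩
    s + - fromℕ (a ℕ.+ f)                    ≈⟨ +-cong s≈t+a (-‿cong (fromℕ-+ a f)) ⟩
    t + fromℕ a + - (fromℕ a + fromℕ f)      ≈⟨ +-congˡ (-‿+-comm (fromℕ a) (fromℕ f)) ⟨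
    t + fromℕ a + (- fromℕ a + - fromℕ f)    ≈⟨ +-assoc (t + fromℕ a) (- fromℕ a) (- fromℕ f) ⟨
    t + fromℕ a + - fromℕ a + - fromℕ f      ≈⟨ +-congʳ (//-rightDividesʳ (fromℕ a) t) ⟩
    t + - fromℕ f                            ≈⟨ frac-nonneg 0≤t ⟨
    frac t                                   ∎
    where f = ∣ floor t ∣

  floor+gap≡ceil⇒gap≤1 : ∀ {x δ} → 0# ≤ x → ∣ floor x ∣ ℕ.+ δ ≡ ∣ ceil x ∣ → δ ℕ.≤ 1
  floor+gap≡ceil⇒gap≤1 {x} {δ} 0≤x f+δ≡c = ℕP.+-cancelˡ-≤ f δ 1
    (ℕP.≤-trans (ℕP.≤-reflexive f+δ≡c)
    (ℕP.≤-trans (ceil≤1+floor (isFloor 0≤x) (ceil-nonneg 0≤x)) (ℕP.≤-reflexive (ℕP.+-comm 1 f))))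
    where f = ∣ floor x ∣

  frac-bounds : ∀ {x δ} → 0# ≤ x → ∣ floor x ∣ ℕ.+ δ ≡ ∣ ceil x ∣ → 0# ≤ frac x × frac x ≤ fromℕ δ
  frac-bounds {x} {δ} 0≤x f+δ≡c = +-cancelʳ-≤ (fromℕ f) lower , +-cancelʳ-≤ (fromℕ f) upper
    where
    f = ∣ floor x ∣
    lower : 0# + fromℕ f ≤ frac x + fromℕ f
    lower = begin
      0# + fromℕ f      ≈⟨ +-identityˡ (fromℕ f) ⟩
      fromℕ f           ≤⟨ proj₁ (isFloor 0≤x) ⟩
      x                 ≈⟨ frac+floor 0≤x ⟨
      frac x + fromℕ f  ∎
    upper : frac x + fromℕ f ≤ fromℕ δ + fromℕ f
    upper = begin
      frac x + fromℕ f    ≈⟨ frac+floor 0≤x ⟩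
      x                   ≤⟨ proj₁ (ceil-nonneg 0≤x) ⟩
      fromℕ ∣ ceil x ∣    ≡⟨ ≡.cong fromℕ f+δ≡c ⟨
      fromℕ (f ℕ.+ δ)     ≈⟨ fromℕ-+ f δ ⟩
      fromℕ f + fromℕ δ   ≈⟨ +-comm (fromℕ f) (fromℕ δ) ⟩
      fromℕ δ + fromℕ f   ∎

-- Degrees in ℕᵏ: pointwise order and addition.

_≼_ : ∀ {k} → Vec ℕ k → Vec ℕ k → Set
m ≼ n = ∀ i → lookup m i ℕ.≤ lookup n i

lookup-⊕ : ∀ {k} (m n : Vec ℕ k) i → lookup (m ⊕ n) i ≡ lookup m i ℕ.+ lookup n i
lookup-⊕ m n i = lookup-zipWith ℕ._+_ i m n

⊕-pointwise : ∀ {k} {p m n : Vec ℕ k} → (∀ i → lookup p i ≡ lookup m i ℕ.+ lookup n i) → p ≡ m ⊕ n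
⊕-pointwise {m = m} {n} p≡m+n = Pointwise-≡⇒≡ (ext λ i → ≡.trans (p≡m+n i) (≡.sym (lookup-⊕ m n i)))

⊕-assoc : ∀ {k} (m n p : Vec ℕ k) → (m ⊕ n) ⊕ p ≡ m ⊕ (n ⊕ p)
⊕-assoc = zipWith-assoc ℕP.+-assoc

⊕-cancelˡ : ∀ {k} (m : Vec ℕ k) {n n'} → m ⊕ n ≡ m ⊕ n' → n ≡ n'
⊕-cancelˡ m {n} {n'} e = Pointwise-≡⇒≡ (ext λ i → ℕP.+-cancelˡ-≡ (lookup m i) _ _
  (≡.trans (≡.sym (lookup-⊕ m n i)) (≡.trans (≡.cong (λ v → lookup v i) e) (lookup-⊕ m n' i))))

≼⇒⊕ : ∀ {k} {m n : Vec ℕ k} → m ≼ n → Σ (Vec ℕ k) λ δ → m ⊕ δ ≡ n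
≼⇒⊕ {m = m} {n} m≼n = δ , ≡.sym (⊕-pointwise λ i → ≡.trans (≡.sym (ℕP.m+[n∸m]≡n (m≼n i))) (≡.cong (lookup m i ℕ.+_) (≡.sym (lookup∘tabulate _ i))))
  where δ = tabulate λ i → lookup n i ℕ.∸ lookup m i

-- Segments λ(m, n) of paths in a k-graph, via the unique factorisation property.
module PathFacts {k : ℕ} (Λ : KGraph k) where
  open KGraph Λ
  open ≡.≡-Reasoning

  factorisation-unique : ∀ {u v a a'} (μ : Path u a) (ν : Path a v) (μ' : Path u a') (ν' : Path a' v) →
    μ ∘ ν ≡ μ' ∘ ν' → d μ ≡ d μ' →
    _≡_ {A = Σ Obj λ b → Path u b × Path b v} (a , μ , ν) (a' , μ' , ν')
  factorisation-unique μ ν μ' ν' μν≡μ'ν' dμ≡dμ' =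
    factor-unique (μ ∘ ν) (d μ) (d ν) μ ν μ' ν' ≡.refl ≡.refl ≡.refl (≡.sym dμ≡dμ') dν'≡dν μν≡μ'ν'
    where
    dν'≡dν : d ν' ≡ d ν
    dν'≡dν = ⊕-cancelˡ (d μ) (begin
      d μ ⊕ d ν'   ≡⟨ ≡.cong (_⊕ d ν') dμ≡dμ' ⟩
      d μ' ⊕ d ν'  ≡⟨ d-∘ μ' ν' ⟨
      d (μ' ∘ ν')  ≡⟨ ≡.cong d μν≡μ'ν' ⟨
      d (μ ∘ ν)    ≡⟨ d-∘ μ ν ⟩
      d μ ⊕ d ν    ∎)

  -- Second factors of equal paths p = μν and p' = μ'ν' with d(μ) = d(μ') agree; p and p' are compared as
  -- paths out of u, since their ranges are not known to be equal in advance.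
  suffix-unique : ∀ {u b b' a a'} {p : Path u b} {p' : Path u b'} →
    _≡_ {A = Σ Obj (Path u)} (b , p) (b' , p') →
    (μ : Path u a) (ν : Path a b) (μ' : Path u a') (ν' : Path a' b') →
    p ≡ μ ∘ ν → p' ≡ μ' ∘ ν' → d μ ≡ d μ' →
    _≡_ {A = AnyPath} (a , b , ν) (a' , b' , ν')
  suffix-unique {b = b} ≡.refl μ ν μ' ν' p≡μν p≡μ'ν' dμ≡dμ' =
    ≡.cong (λ { (a , _ , ν) → a , b , ν }) (factorisation-unique μ ν μ' ν' (≡.trans (≡.sym p≡μν) p≡μ'ν') dμ≡dμ')

  segment-exists : ∀ {u w} (l : Path u w) {m n} → m ≼ n → n ≼ d l → Σ AnyPath (Segment (u , w , l) m n)
  segment-exists l {m} {n} m≼n n≼dl with ≼⇒⊕ m≼n | ≼⇒⊕ n≼dl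
  ... | δ , m⊕δ≡n | η , n⊕η≡dl with factor l n η (≡.sym n⊕η≡dl)
  ... | v , μ , ν , dμ≡n , _ , l≡μν with factor μ m δ (≡.trans dμ≡n (≡.sym m⊕δ≡n))
  ... | a , l' , τ , dl'≡m , dτ≡δ , μ≡l'τ =
    (a , v , τ) , l' , ν , ≡.trans l≡μν (≡.cong (_∘ ν) μ≡l'τ) , dl'≡m , ≡.trans (≡.cong (m ⊕_) dτ≡δ) m⊕δ≡n

  -- The segment l(m, n) is unique: factor l at n, then its prefix at m.
  segment-unique : ∀ {l m n τ τ'} → Segment l m n τ → Segment l m n τ' → τ ≡ τ'
  segment-unique {u , w , l} {m} {n} {a , b , τ} {a' , b' , τ'}
    (l₁ , l₃ , l≡l₁τl₃ , dl₁≡m , m⊕dτ≡n) (l₁' , l₃' , l≡l₁'τ'l₃' , dl₁'≡m , m⊕dτ'≡n) =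
    suffix-unique (≡.cong (λ { (b , p , _) → b , p }) prefixes-equal) l₁ τ l₁' τ' ≡.refl ≡.refl
      (≡.trans dl₁≡m (≡.sym dl₁'≡m))
    where
    degree-n : ∀ {a b} {l₁ : Path _ a} {τ : Path a b} → d l₁ ≡ m → m ⊕ d τ ≡ n → d (l₁ ∘ τ) ≡ n
    degree-n {l₁ = l₁} {τ} dl₁≡m m⊕dτ≡n = ≡.trans (d-∘ l₁ τ) (≡.trans (≡.cong (_⊕ d τ) dl₁≡m) m⊕dτ≡n)
    prefixes-equal : _≡_ {A = Σ Obj λ c → Path u c × Path c w} (b , l₁ ∘ τ , l₃) (b' , l₁' ∘ τ' , l₃')
    prefixes-equal = factorisation-unique (l₁ ∘ τ) l₃ (l₁' ∘ τ') l₃' (≡.trans (≡.sym l≡l₁τl₃) l≡l₁'τ'l₃')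
      (≡.trans (degree-n dl₁≡m m⊕dτ≡n) (≡.sym (degree-n dl₁'≡m m⊕dτ'≡n)))

  segment-extend : ∀ {u v w x m n τ} (α : Path u v) {l : Path v w} (β : Path w x) →
    Segment (v , w , l) m n τ → Segment (u , x , (α ∘ l) ∘ β) (d α ⊕ m) (d α ⊕ n) τ
  segment-extend {m = m} {τ = _ , _ , τ} α {l} β (l₁ , l₃ , l≡l₁τl₃ , dl₁≡m , m⊕dτ≡n) =
    α ∘ l₁ , l₃ ∘ β , path-eq , ≡.trans (d-∘ α l₁) (≡.cong (d α ⊕_) dl₁≡m) ,
    ≡.trans (⊕-assoc (d α) m (d τ)) (≡.cong (d α ⊕_) m⊕dτ≡n)
    where
    path-eq : (α ∘ l) ∘ β ≡ ((α ∘ l₁) ∘ τ) ∘ (l₃ ∘ β)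
    path-eq = begin
      (α ∘ l) ∘ β                   ≡⟨ ≡.cong (λ p → (α ∘ p) ∘ β) l≡l₁τl₃ ⟩
      (α ∘ ((l₁ ∘ τ) ∘ l₃)) ∘ β     ≡⟨ ≡.cong (_∘ β) (assoc α (l₁ ∘ τ) l₃) ⟨
      ((α ∘ (l₁ ∘ τ)) ∘ l₃) ∘ β     ≡⟨ assoc (α ∘ (l₁ ∘ τ)) l₃ β ⟩
      (α ∘ (l₁ ∘ τ)) ∘ (l₃ ∘ β)     ≡⟨ ≡.cong (_∘ (l₃ ∘ β)) (assoc α l₁ τ) ⟨
      ((α ∘ l₁) ∘ τ) ∘ (l₃ ∘ β)     ∎

-- The relation ∼ versus the equivalence relation generated by Gen.

module Cube {k : ℕ} (Λ : KGraph k) (ℝ : RealNumbers) where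
  open KGraph Λ
  open Topological Λ ℝ
  open RealNumbers ℝ using (Carrier; 0#; _≤_; floor; ceil; fromℕ)
  open RealFacts ℝ
  open PathFacts Λ
  open CommutativeRing commutativeRing using (_≈_; _+_; sym; trans; reflexive; +-identityʳ; +-congˡ)

  _∈[0,_] : (Fin k → Carrier) → Vec ℕ k → Set
  t ∈[0, n ] = ∀ i → 0# ≤ t i × t i ≤ fromℕ (lookup n i)

  Nonneg : (Fin k → Carrier) → Set
  Nonneg t = ∀ i → 0# ≤ t i

  nonneg : ∀ {t n} → t ∈[0, n ] → Nonneg t
  nonneg t∈ i = proj₁ (t∈ i)

  lookup-⌊⌋ : ∀ t i → lookup ⌊ t ⌋ i ≡ ∣ floor (t i) ∣
  lookup-⌊⌋ t i = lookup∘tabulate _ i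

  lookup-⌈⌉ : ∀ t i → lookup ⌈ t ⌉ i ≡ ∣ ceil (t i) ∣
  lookup-⌈⌉ t i = lookup∘tabulate _ i

  point-segment : ∀ {u w} {l : Path u w} {t} → t ∈[0, d l ] → Σ AnyPath (Segment (u , w , l) ⌊ t ⌋ ⌈ t ⌉)
  point-segment {l = l} {t} t∈ = segment-exists l ⌊t⌋≼⌈t⌉ ⌈t⌉≼dl
    where
    t≥0 : Nonneg t
    t≥0 = nonneg {n = d l} t∈
    ⌊t⌋≼⌈t⌉ : ⌊ t ⌋ ≼ ⌈ t ⌉
    ⌊t⌋≼⌈t⌉ i rewrite lookup-⌊⌋ t i | lookup-⌈⌉ t i =
      floor≤ceil (isFloor (t≥0 i)) (ceil-nonneg (t≥0 i))
    ⌈t⌉≼dl : ⌈ t ⌉ ≼ d l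
    ⌈t⌉≼dl i rewrite lookup-⌈⌉ t i = proj₂ (ceil-nonneg (t≥0 i)) _ (proj₂ (t∈ i))

  -- reflexivity holds since every point has a segment l(⌊t⌋, ⌈t⌉)
  ∼-refl : ∀ {x} → x ∼ x
  ∼-refl {_ , _ , t∈} with point-segment t∈
  ... | τ , τ-seg = (τ , τ-seg , τ-seg) , λ i → CommutativeRing.refl commutativeRing

  ∼-sym : ∀ {x y} → x ∼ y → y ∼ x
  ∼-sym ((τ , x-seg , y-seg) , fracs≈) = (τ , y-seg , x-seg) , λ i → sym (fracs≈ i)

  -- transitivity holds since the segment of the middle point is unique
  ∼-trans : ∀ {x y z} → x ∼ y → y ∼ z → x ∼ z
  ∼-trans {z = l , t , _} ((τ , x-seg , y-seg) , fracs≈) ((τ' , y-seg' , z-seg) , fracs≈') =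
    (τ , x-seg , ≡.subst (Segment l ⌊ t ⌋ ⌈ t ⌉) (≡.sym (segment-unique y-seg y-seg')) z-seg) ,
    λ i → trans (fracs≈ i) (fracs≈' i)

  ∼-isEquivalence : IsEquivalence _∼_
  ∼-isEquivalence = record
    { refl  = λ {x} → ∼-refl {x}
    ; sym   = λ {x} {y} → ∼-sym {x} {y}
    ; trans = λ {x} {y} {z} → ∼-trans {x} {y} {z}
    }

  ⌊⌋-shift : ∀ {s t} (a : Vec ℕ k) → Nonneg t → (∀ i → s i ≈ t i + fromℕ (lookup a i)) → ⌊ s ⌋ ≡ a ⊕ ⌊ t ⌋
  ⌊⌋-shift {s} {t} a t≥0 s≈t+a = ⊕-pointwise λ i →
    ≡.trans (lookup-⌊⌋ s i) (≡.trans (floor-shift (t≥0 i) (s≈t+a i)) (≡.cong (lookup a i ℕ.+_) (≡.sym (lookup-⌊⌋ t i))))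

  ⌈⌉-shift : ∀ {s t} (a : Vec ℕ k) → Nonneg t → (∀ i → s i ≈ t i + fromℕ (lookup a i)) → ⌈ s ⌉ ≡ a ⊕ ⌈ t ⌉
  ⌈⌉-shift {s} {t} a t≥0 s≈t+a = ⊕-pointwise λ i →
    ≡.trans (lookup-⌈⌉ s i) (≡.trans (ceil-shift (t≥0 i) (s≈t+a i)) (≡.cong (lookup a i ℕ.+_) (≡.sym (lookup-⌈⌉ t i))))

  -- Each generating pair is ∼-related: (αλβ, t + d(α)) has the segment (αλβ)(d(α) + ⌊t⌋, d(α) + ⌈t⌉) = λ(⌊t⌋, ⌈t⌉)
  -- and the same fractional part as (λ, t).
  Gen⇒∼ : ∀ {x y} → Gen x y → x ∼ y
  Gen⇒∼ {_ , s , _} {(_ , _ , l) , t , t∈} (_ , _ , _ , α , β , ≡.refl , s≈t+dα) with point-segment t∈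
  ... | τ , τ-seg =
    (τ , ≡.subst₂ (λ m n → Segment _ m n τ) (≡.sym ⌊s⌋≡) (≡.sym ⌈s⌉≡) (segment-extend α β τ-seg) , τ-seg) ,
    λ i → frac-shift {a = lookup (d α) i} (t≥0 i) (s≈t+dα i)
    where
    t≥0 : Nonneg t
    t≥0 = nonneg {n = d l} t∈
    ⌊s⌋≡ : ⌊ s ⌋ ≡ d α ⊕ ⌊ t ⌋
    ⌊s⌋≡ = ⌊⌋-shift (d α) t≥0 s≈t+dα
    ⌈s⌉≡ : ⌈ s ⌉ ≡ d α ⊕ ⌈ t ⌉
    ⌈s⌉≡ = ⌈⌉-shift (d α) t≥0 s≈t+dα

  gap-coordinate : ∀ {t δ} → ⌊ t ⌋ ⊕ δ ≡ ⌈ t ⌉ → ∀ i → ∣ floor (t i) ∣ ℕ.+ lookup δ i ≡ ∣ ceil (t i) ∣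
  gap-coordinate {t} {δ} gap i = begin
    ∣ floor (t i) ∣ ℕ.+ lookup δ i  ≡⟨ ≡.cong (ℕ._+ lookup δ i) (lookup-⌊⌋ t i) ⟨
    lookup ⌊ t ⌋ i ℕ.+ lookup δ i   ≡⟨ lookup-⊕ ⌊ t ⌋ δ i ⟨
    lookup (⌊ t ⌋ ⊕ δ) i            ≡⟨ ≡.cong (λ v → lookup v i) gap ⟩
    lookup ⌈ t ⌉ i                  ≡⟨ lookup-⌈⌉ t i ⟩
    ∣ ceil (t i) ∣                  ∎
    where open ≡.≡-Reasoning

  gap≤1 : ∀ {t δ} → Nonneg t → ⌊ t ⌋ ⊕ δ ≡ ⌈ t ⌉ → ∀ i → lookup δ i ℕ.≤ 1
  gap≤1 t≥0 gap i = floor+gap≡ceil⇒gap≤1 (t≥0 i) (gap-coordinate gap i)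

  cube-point : (τ : AnyPath) (t : Fin k → Carrier) → Nonneg t → ⌊ t ⌋ ⊕ dA τ ≡ ⌈ t ⌉ → Point
  cube-point τ t t≥0 gap = τ , (λ i → frac (t i)) , λ i → frac-bounds (t≥0 i) (gap-coordinate gap i)

  to-cube : ∀ {u w a b} {l : Path u w} {t} (t∈ : t ∈[0, d l ]) {l₁ : Path u a} {τ : Path a b} {l₃ : Path b w} →
    l ≡ (l₁ ∘ τ) ∘ l₃ → d l₁ ≡ ⌊ t ⌋ → (gap : ⌊ t ⌋ ⊕ d τ ≡ ⌈ t ⌉) →
    Gen ((u , w , l) , t , t∈) (cube-point (a , b , τ) t (nonneg {n = d l} t∈) gap)
  to-cube {u} {w} {l = l} {t} t∈ {l₁} {τ} {l₃} l≡l₁τl₃ dl₁≡⌊t⌋ gap =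
    gap≤1 (nonneg {n = d l} t∈) gap , u , w , l₁ , l₃ , ≡.cong (λ p → u , w , p) l≡l₁τl₃ , t≈frac+dl₁
    where
    t≈frac+dl₁ : ∀ i → t i ≈ frac (t i) + fromℕ (lookup (d l₁) i)
    t≈frac+dl₁ i = sym (trans
      (+-congˡ (reflexive (≡.cong fromℕ (≡.trans (≡.cong (λ v → lookup v i) dl₁≡⌊t⌋) (lookup-⌊⌋ t i)))))
      (frac+floor (proj₁ (t∈ i))))

  -- Two cube points on the same cube with equal coordinates are related by a generator with α = β = identity.
  cube-Gen : ∀ {τ s t} (s≥0 : Nonneg s) (t≥0 : Nonneg t) (gapₛ : ⌊ s ⌋ ⊕ dA τ ≡ ⌈ s ⌉) (gapₜ : ⌊ t ⌋ ⊕ dA τ ≡ ⌈ t ⌉) →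
    (∀ i → frac (s i) ≈ frac (t i)) →
    Gen (cube-point τ s s≥0 gapₛ) (cube-point τ t t≥0 gapₜ)
  cube-Gen {a , b , τ} _ t≥0 _ gapₜ fracs≈ =
    gap≤1 t≥0 gapₜ , a , b , idP , idP , ≡.cong (λ p → a , b , p) (≡.sym (≡.trans (idʳ _) (idˡ τ))) ,
    λ i → trans (fracs≈ i) (sym (trans (+-congˡ (reflexive (≡.cong fromℕ (d-idP-coordinate i)))) (+-identityʳ _)))
    where
    d-idP-coordinate : ∀ i → lookup (d (idP {a})) i ≡ 0
    d-idP-coordinate i = ≡.trans (≡.cong (λ v → lookup v i) d-id) (lookup-replicate i 0)

  -- Conversely, x ∼ y with common segment τ is witnessed by the zig-zag x → (τ, frac) ← y through two cube points.
  ∼⇒Generated : ∀ {x y} → x ∼ y → Generated x y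
  ∼⇒Generated {x@((_ , _ , l) , s , s∈)} {y@((_ , _ , l') , t , t∈)}
    ((τ , (_ , _ , l≡ , dl₁ , gapₛ) , (_ , _ , l'≡ , dl₁' , gapₜ)) , fracs≈) = x→zₛ ◅ zₛ→zₜ ◅ zₜ←y ◅ ε
    where
    s≥0 : Nonneg s
    s≥0 = nonneg {n = d l} s∈
    t≥0 : Nonneg t
    t≥0 = nonneg {n = d l'} t∈
    zₛ zₜ : Point
    zₛ = cube-point τ s s≥0 gapₛ
    zₜ = cube-point τ t t≥0 gapₜ
    x→zₛ : SymClosure Gen x zₛ
    x→zₛ = fwd (to-cube {l = l} s∈ l≡ dl₁ gapₛ)
    zₛ→zₜ : SymClosure Gen zₛ zₜ
    zₛ→zₜ = fwd (cube-Gen s≥0 t≥0 gapₛ gapₜ fracs≈)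
    zₜ←y : SymClosure Gen zₜ y
    zₜ←y = bwd (to-cube {l = l'} t∈ l'≡ dl₁' gapₜ)

mainTheorem13 : {k : ℕ} (Λ : KGraph k) (ℝ : RealNumbers) →
    let open Topological Λ ℝ in
    ∀ (x y : Point) → (x ∼ y → Generated x y) × (Generated x y → x ∼ y)
mainTheorem13 Λ ℝ x y = ∼⇒Generated , fold ∼-isEquivalence (λ {x} {y} → Gen⇒∼ {x} {y})
  where open Cube Λ ℝ
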